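{- Let $\sigma\ge2$ be an even integer. Then $v(w_\sigma)=2\sigma+\sigma/2-2$.
   Context: Let $\Sigma=\{a_1,\dots,a_\sigma\}$ with $a_1<\cdots<a_\sigma$, and $w_\sigma=\left(\prod_{i=1}^{\sigma-1}a_ia_{i+1}\right)\left(\prod_{i=1}^{\sigma}a_i\right)$ (concatenation in increasing $i$). Strings are compared lexicographically. The lex-parse of a string $w$ of length $n$ is the factorization $w=x_1\cdots x_v$ defined left to right: if phrase $x_j$ starts at position $i=1+\sum_{t<j}|x_t|$, its length is $\max\{1,\ell\}$, where $\ell$ is the length of the longest common prefix of $w[i\ldots n]$ with the suffix of $w$ immediately preceding it in lexicographic order among all suffixes of $w$ ($\ell=0$ if $w[i\ldots n]$ is the smallest suffix). $v(w)$ is the number of phrases. -}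

module Defs where

open import Data.Nat using (ℕ; zero; suc; _+_; _∸_; _<ᵇ_; _≡ᵇ_; _⊔_)
open import Data.Bool using (Bool; true; false; if_then_else_)
open import Data.List using (List; []; _∷_; _++_; map; concatMap; upTo; length; drop)
open import Data.Maybe using (Maybe; just; nothing)

-- Strings over the ordered alphabet ℕ (letter a_i is represented by i).
Word : Set
Word = List ℕ

lexLt : Word → Word → Bool
lexLt []       []       = false
lexLt []       (_ ∷ _)  = true
lexLt (_ ∷ _)  []       = false
lexLt (x ∷ xs) (y ∷ ys) =
  if x <ᵇ y then true else (if y <ᵇ x then false else lexLt xs ys)

lcp : Word → Word → ℕ
lcp []       _        = 0
lcp (_ ∷ _)  []       = 0
lcp (x ∷ xs) (y ∷ ys) = if x ≡ᵇ y then suc (lcp xs ys) else 0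

-- All (nonempty) suffixes w[i..n], i = 1..n  (here: drop i w, i = 0..n-1).
suffixes : Word → List Word
suffixes w = map (λ i → drop i w) (upTo (length w))

predIn : Word → List Word → Maybe Word
predIn s []       = nothing
predIn s (t ∷ ts) with predIn s ts
... | nothing = if lexLt t s then just t else nothing
... | just u  = if lexLt t s then (if lexLt u t then just t else just u) else just u

-- ℓ for the suffix of w starting at (0-based) position i:
-- lcp with the suffix immediately preceding it in lex order; 0 if it is smallest.
ellAt : Word → ℕ → ℕ
ellAt w i with predIn (drop i w) (suffixes w)
... | nothing = 0
... | just u  = lcp (drop i w) u

-- Number of phrases of the lex-parse, starting at 0-based position i,
-- with fuel (each phrase has length ≥ 1, so fuel = |w| suffices).
parseCount : ℕ → Word → ℕ → ℕ
parseCount zero     w i = 0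
parseCount (suc f)  w i =
  if i <ᵇ length w then suc (parseCount f w (i + (1 ⊔ ellAt w i))) else 0

v : Word → ℕ
v w = parseCount (length w) w 0

-- w_σ = (∏_{i=1}^{σ-1} a_i a_{i+1}) (∏_{i=1}^{σ} a_i) with a_i = i.
wσ : ℕ → Word
wσ σ = concatMap (λ i → suc i ∷ suc (suc i) ∷ []) (upTo (σ ∸ 1))
       ++ map suc (upTo σ)

{-# OPTIONS --safe #-}

-- Write w_σ = 1 2 2 3 3 … (σ-1) σ · 1 2 … σ. A suffix starting with the letter a is
-- a (a+1) (a+1) … (at a pair), a a (a+1) … (inside a pair) or a (a+1) (a+2) … (in the final
-- ascent), so two distinct suffixes share at most two letters. Through the pairs each letter is a
-- phrase of its own, except the last pair (σ-1) σ, whose lex predecessor is the suffix (σ-1) σ.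
-- In the ascent, a (a+1) (a+2) … is preceded by a (a+1) (a+1) …, so the ascent is cut into
-- phrases of length two up to its last two letters. For even σ this gives
-- 2(σ-2) + 1 + (σ-2)/2 + 2 = 2σ + σ/2 - 2 phrases.

module Submission where

open import Defs
open import Data.Nat using (ℕ; _+_; _*_; _∸_; _≤_)
open import Data.Nat.Divisibility using (_∣_)
open import Data.Nat.DivMod using (_/_)
open import Relation.Binary.PropositionalEquality using (_≡_)

open import Data.Nat using (zero; suc; _<_; z≤n; s≤s; _<ᵇ_; _≡ᵇ_; _⊔_)
open import Data.Nat.Properties
open import Data.Nat.Divisibility using (divides)
open import Data.Nat.DivMod using (m*n/n≡m)
open import Data.Nat.Tactic.RingSolver using (solve-∀)
open import Data.Bool using (true; false)
open import Data.Bool.Properties using (not-¬)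
open import Data.List using (List; []; _∷_; _++_; map; length; drop; upTo; applyUpTo; concatMap)
open import Data.List.Properties using (length-drop)
open import Data.List.Membership.Propositional using (_∈_)
open import Data.List.Membership.Propositional.Properties using (∈-map⁺; ∈-map⁻; ∈-upTo⁺)
open import Data.List.Relation.Unary.Any using (here; there)
open import Data.Maybe using (Maybe; just; nothing)
open import Data.Product using (_,_)
open import Data.Empty using (⊥-elim)
open import Function using (_∘_)
open import Relation.Nullary using (¬_; yes; no)
open import Relation.Nullary.Reflects using (Reflects; ofʸ; ofⁿ; det; fromEquivalence)
open import Relation.Binary using (tri<; tri≈; tri>)
open import Relation.Binary.PropositionalEquality
  using (_≢_; refl; sym; trans; cong; cong₂; subst; ≢-sym; module ≡-Reasoning)

≡ᵇ-reflects-≡ : ∀ m n → Reflects (m ≡ n) (m ≡ᵇ n)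
≡ᵇ-reflects-≡ m n = fromEquivalence (≡ᵇ⇒≡ m n) (≡⇒≡ᵇ m n)

_≺_ : Word → Word → Set
s ≺ t = lexLt s t ≡ true

lexLt-∷-< : ∀ {x y} s t → x < y → (x ∷ s) ≺ (y ∷ t)
lexLt-∷-< {x} {y} _ _ x<y rewrite det (<ᵇ-reflects-< x y) (ofʸ x<y) = refl

lexLt-∷-> : ∀ {x y} s t → y < x → lexLt (x ∷ s) (y ∷ t) ≡ false
lexLt-∷-> {x} {y} _ _ y<x
  rewrite det (<ᵇ-reflects-< x y) (ofⁿ (<⇒≯ y<x)) | det (<ᵇ-reflects-< y x) (ofʸ y<x) = refl

lexLt-∷-≡ : ∀ x s t → lexLt (x ∷ s) (x ∷ t) ≡ lexLt s t
lexLt-∷-≡ x _ _ rewrite det (<ᵇ-reflects-< x x) (ofⁿ (n≮n x)) = refl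

lexLt-++ : ∀ u s t → lexLt (u ++ s) (u ++ t) ≡ lexLt s t
lexLt-++ []      s t = refl
lexLt-++ (x ∷ u) s t = trans (lexLt-∷-≡ x (u ++ s) (u ++ t)) (lexLt-++ u s t)

lexLt-irrefl : ∀ s → lexLt s s ≡ false
lexLt-irrefl []      = refl
lexLt-irrefl (x ∷ s) = trans (lexLt-∷-≡ x s s) (lexLt-irrefl s)

≺-trans : ∀ s t u → s ≺ t → t ≺ u → s ≺ u
≺-trans []      (_ ∷ _) (_ ∷ _) _   _   = refl
≺-trans (x ∷ s) (y ∷ t) (z ∷ u) s<t t<u with <-cmp x y | <-cmp y z
... | tri> _ _ y<x | _ = ⊥-elim (not-¬ (lexLt-∷-> s t y<x) s<t)
... | _ | tri> _ _ z<y = ⊥-elim (not-¬ (lexLt-∷-> t u z<y) t<u)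
... | tri< x<y _ _ | tri< y<z _ _ = lexLt-∷-< s u (<-trans x<y y<z)
... | tri< x<y _ _ | tri≈ _ refl _ = lexLt-∷-< s u x<y
... | tri≈ _ refl _ | tri< y<z _ _ = lexLt-∷-< s u y<z
... | tri≈ _ refl _ | tri≈ _ refl _ =
  trans (lexLt-∷-≡ x s u)
    (≺-trans s t u (trans (sym (lexLt-∷-≡ x s t)) s<t) (trans (sym (lexLt-∷-≡ x t u)) t<u))

≺-asym : ∀ s t → s ≺ t → lexLt t s ≡ false
≺-asym s t s<t with lexLt t s in t<s
... | false = refl
... | true  = ⊥-elim (not-¬ (lexLt-irrefl s) (≺-trans s t s s<t t<s))

lcp-∷-≢ : ∀ {x y} s t → x ≢ y → lcp (x ∷ s) (y ∷ t) ≡ 0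
lcp-∷-≢ {x} {y} _ _ x≢y
  rewrite det (≡ᵇ-reflects-≡ x y) (ofⁿ x≢y) = refl

lcp-++ : ∀ u s t → lcp (u ++ s) (u ++ t) ≡ length u + lcp s t
lcp-++ []      s t = refl
lcp-++ (x ∷ u) s t
  rewrite det (≡ᵇ-reflects-≡ x x) (ofʸ refl) = cong suc (lcp-++ u s t)

lcp-++-≢ : ∀ u {x y} s t → x ≢ y → lcp (u ++ x ∷ s) (u ++ y ∷ t) ≡ length u
lcp-++-≢ u {x} {y} s t x≢y = begin
  lcp (u ++ x ∷ s) (u ++ y ∷ t)  ≡⟨ lcp-++ u (x ∷ s) (y ∷ t) ⟩
  length u + lcp (x ∷ s) (y ∷ t) ≡⟨ cong (length u +_) (lcp-∷-≢ s t x≢y) ⟩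
  length u + 0                   ≡⟨ +-identityʳ (length u) ⟩
  length u                       ∎
  where open ≡-Reasoning

lcp-≤-length : ∀ s t → lcp s t ≤ length s
lcp-≤-length []      _       = z≤n
lcp-≤-length (x ∷ s) []      = z≤n
lcp-≤-length (x ∷ s) (y ∷ t) with x ≟ y
... | yes refl = subst (_≤ length (x ∷ s)) (sym (lcp-++ (x ∷ []) s t)) (s≤s (lcp-≤-length s t))
... | no x≢y   = subst (_≤ length (x ∷ s)) (sym (lcp-∷-≢ s t x≢y)) z≤n

lcp-mono : ∀ s t p → t ≺ s → p ≺ s → ¬ p ≺ t → lcp s t ≤ lcp s p
lcp-mono (x ∷ s) []      _       _   _   _   = z≤n
lcp-mono (x ∷ s) (y ∷ t) []      _   _   p⊀t = ⊥-elim (p⊀t refl)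
lcp-mono (x ∷ s) (y ∷ t) (z ∷ p) t<s p<s p⊀t with y ≟ x
... | no y≢x = subst (_≤ _) (sym (lcp-∷-≢ s t (≢-sym y≢x))) z≤n
... | yes refl with <-cmp z y
...   | tri< z<y _ _ = ⊥-elim (p⊀t (lexLt-∷-< p t z<y))
...   | tri> _ _ y<z = ⊥-elim (not-¬ (lexLt-∷-> p s y<z) p<s)
...   | tri≈ _ refl _
  rewrite lcp-++ (y ∷ []) s t | lcp-++ (y ∷ []) s p
        | lexLt-∷-≡ y t s | lexLt-∷-≡ y p s | lexLt-∷-≡ y p t =
  s≤s (lcp-mono s t p t<s p<s p⊀t)

data Predecessor (s : Word) (L : List Word) : Maybe Word → Set where
  none : (∀ {t} → t ∈ L → ¬ t ≺ s) → Predecessor s L nothing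
  some : ∀ {p} → p ∈ L → p ≺ s → (∀ {t} → t ∈ L → t ≺ s → ¬ p ≺ t) →
         Predecessor s L (just p)

predIn-correct : ∀ s L → Predecessor s L (predIn s L)
predIn-correct s []       = none λ ()
predIn-correct s (t ∷ ts) with predIn s ts | predIn-correct s ts
... | nothing | none below with lexLt t s in t<s?
...   | false = none λ { (here refl) → not-¬ t<s? ; (there t′∈) → below t′∈ }
...   | true  = some (here refl) t<s?
                  λ { (here refl) _ → not-¬ (lexLt-irrefl t)
                    ; (there t′∈) t′<s → ⊥-elim (below t′∈ t′<s) }
predIn-correct s (t ∷ ts) | just u | some u∈ u<s max with lexLt t s in t<s?
...   | false = some (there u∈) u<s
                  λ { (here refl) t<s → ⊥-elim (not-¬ t<s? t<s) ; (there t′∈) → max t′∈ }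
...   | true with lexLt u t in u<t?
...     | true  = some (here refl) t<s?
                    λ { (here refl) _ → not-¬ (lexLt-irrefl t)
                      ; {t′} (there t′∈) t′<s t<t′ →
                          max t′∈ t′<s (≺-trans u t t′ u<t? t<t′) }
...     | false = some (there u∈) u<s
                    λ { (here refl) _ → not-¬ u<t? ; (there t′∈) → max t′∈ }

record LcpBound (K : ℕ) (s t : Word) : Set where
  constructor lcpBound
  field lcp-≤ : t ≺ s → lcp s t ≤ K

lcpBound-⊀ : ∀ {K s t} → lexLt t s ≡ false → LcpBound K s t
lcpBound-⊀ t⊀s = lcpBound λ t<s → ⊥-elim (not-¬ t⊀s t<s)

lcpBound-refl : ∀ {K s} → LcpBound K s s
lcpBound-refl {s = s} = lcpBound-⊀ (lexLt-irrefl s)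

lcpBound-≡ : ∀ {K m s t} → lcp s t ≡ m → m ≤ K → LcpBound K s t
lcpBound-≡ eq m≤K = lcpBound λ _ → subst (_≤ _) (sym eq) m≤K

ellAt-≤ : ∀ w {i K} → (∀ {t} → t ∈ suffixes w → LcpBound K (drop i w) t) → ellAt w i ≤ K
ellAt-≤ w {i} bound
  with predIn (drop i w) (suffixes w) | predIn-correct (drop i w) (suffixes w)
... | nothing | _              = z≤n
... | just p  | some p∈ p<s _ = LcpBound.lcp-≤ (bound p∈) p<s

ellAt-≥ : ∀ w {i K t} → t ∈ suffixes w → t ≺ drop i w → K ≤ lcp (drop i w) t →
          K ≤ ellAt w i
ellAt-≥ w {i} {t = t} t∈ t<s K≤
  with predIn (drop i w) (suffixes w) | predIn-correct (drop i w) (suffixes w)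
... | nothing | none below       = ⊥-elim (below t∈ t<s)
... | just p  | some _ p<s max = ≤-trans K≤ (lcp-mono (drop i w) t p t<s p<s (max t∈ t<s))

drop-∷ : ∀ (w : Word) i {x t} → drop i w ≡ x ∷ t → drop (suc i) w ≡ t
drop-∷ (_ ∷ _) zero    refl = refl
drop-∷ (_ ∷ w) (suc i) d    = drop-∷ w i d

drop-∷⇒< : ∀ (w : Word) i {x t} → drop i w ≡ x ∷ t → i < length w
drop-∷⇒< w i d =
  m∸n≢0⇒n<m λ w∸i≡0 → 1+n≢0 (trans (cong length (sym d)) (trans (length-drop i w) w∸i≡0))

drop-∈-suffixes : ∀ (w : Word) i {x t} → drop i w ≡ x ∷ t → x ∷ t ∈ suffixes w
drop-∈-suffixes w i d =
  subst (_∈ suffixes w) d (∈-map⁺ (λ j → drop j w) (∈-upTo⁺ (drop-∷⇒< w i d)))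

TailClosed : (Word → Set) → Set
TailClosed P = ∀ {x t} → P (x ∷ t) → P t

drop-closed : ∀ P → TailClosed P → ∀ i w → P w → P (drop i w)
drop-closed P closed zero    w       pw = pw
drop-closed P closed (suc i) []      pw = pw
drop-closed P closed (suc i) (x ∷ w) pw = drop-closed P closed i w (closed {x} {w} pw)

∈-suffixes-closed : ∀ P {w t} → TailClosed P → P w → t ∈ suffixes w → P t
∈-suffixes-closed P {w} closed pw t∈ with i , _ , refl ← ∈-map⁻ (λ j → drop j w) t∈ =
  drop-closed P closed i w pw

ellAt-singleton : ∀ w {i x} → drop i w ≡ x ∷ [] → ellAt w i ≤ 1
ellAt-singleton w {x = x} d = ellAt-≤ w λ {t} _ →
  lcpBound λ _ → subst (λ s → lcp s t ≤ 1) (sym d) (lcp-≤-length (x ∷ []) t)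

PhraseCount : Word → ℕ → ℕ → Set
PhraseCount w i c = ∀ f → parseCount (c + f) w i ≡ c

parseCount-≤ : ∀ f w i → parseCount f w i ≤ length w ∸ i
parseCount-≤ zero    w i = z≤n
parseCount-≤ (suc f) w i with i <ᵇ length w | <ᵇ-reflects-< i (length w)
... | false | _        = z≤n
... | true  | ofʸ i<n =
  ≤-<-trans (parseCount-≤ f w (i + (1 ⊔ ellAt w i)))
    (≤-<-trans (∸-monoʳ-≤ (length w) (m<m+n i (m≤m⊔n 1 (ellAt w i))))
               (∸-monoʳ-< (n<1+n i) i<n))

phraseCount⇒v : ∀ {w c} → PhraseCount w 0 c → v w ≡ c
phraseCount⇒v {w} {c} count = begin
  parseCount (length w) w 0           ≡⟨ cong (λ f → parseCount f w 0) (m+[n∸m]≡n c≤n) ⟨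
  parseCount (c + (length w ∸ c)) w 0 ≡⟨ count (length w ∸ c) ⟩
  c                                   ∎
  where
  open ≡-Reasoning
  c≤n : c ≤ length w
  c≤n = subst (_≤ length w) (count 0) (parseCount-≤ (c + 0) w 0)

phraseCount-[] : ∀ w i → drop i w ≡ [] → PhraseCount w i 0
phraseCount-[] w i d zero = refl
phraseCount-[] w i d (suc f)
  rewrite det (<ᵇ-reflects-< i (length w))
              (ofⁿ (≤⇒≯ (m∸n≡0⇒m≤n (trans (sym (length-drop i w)) (cong length d))))) = refl

phraseCount-step : ∀ w i {x t k c} → drop i w ≡ x ∷ t → 1 ⊔ ellAt w i ≡ k →
                   PhraseCount w (k + i) c → PhraseCount w i (suc c)
phraseCount-step w i {k = k} d phrase-length count f
  rewrite det (<ᵇ-reflects-< i (length w)) (ofʸ (drop-∷⇒< w i d)) | phrase-length | +-comm i k =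
  cong suc (count f)

phraseCount-short : ∀ w i {x t c} → drop i w ≡ x ∷ t → ellAt w i ≤ 1 →
                    PhraseCount w (suc i) c → PhraseCount w i (suc c)
phraseCount-short w i d ell≤1 = phraseCount-step w i d (m≥n⇒m⊔n≡m ell≤1)

phraseCount-two : ∀ w i {x t c} → drop i w ≡ x ∷ t → ellAt w i ≡ 2 →
                  PhraseCount w (suc (suc i)) c → PhraseCount w i (suc c)
phraseCount-two w i d ell≡2 = phraseCount-step w i d (cong (1 ⊔_) ell≡2)

-- ascent a r = a (a+1) … (a+r), split so that it is a cons for every r.
mutual
  ascent : ℕ → ℕ → Word
  ascent a r = a ∷ ascent⁺ a r

  ascent⁺ : ℕ → ℕ → Word
  ascent⁺ a zero    = []
  ascent⁺ a (suc r) = ascent (suc a) r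

map-suc-applyUpTo : ∀ r {a} (f : ℕ → ℕ) → (∀ i → f i ≡ i + a) →
                    map suc (applyUpTo f (suc r)) ≡ ascent (suc a) r
map-suc-applyUpTo zero    f f≗ = cong (λ x → suc x ∷ []) (f≗ 0)
map-suc-applyUpTo (suc r) f f≗ =
  cong₂ (λ x xs → suc x ∷ xs) (f≗ 0)
    (map-suc-applyUpTo r (f ∘ suc) λ i → trans (f≗ (suc i)) (sym (+-suc i _)))

module Staircase (n : ℕ) where

  σ : ℕ
  σ = suc (suc n)

  -- pairs a r = a (a+1) (a+1) (a+2) … (σ-1) σ 1 2 … σ is the suffix of w starting at the
  -- pair a (a+1), where r = σ - a; pairs′ a r starts one letter earlier, inside the pair (a-1) a.
  mutual
    pairs : ℕ → ℕ → Word
    pairs a zero    = ascent 1 (suc n)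
    pairs a (suc r) = a ∷ pairs′ (suc a) r

    pairs′ : ℕ → ℕ → Word
    pairs′ a r = a ∷ pairs a r

  w : Word
  w = pairs 1 (suc n)

  pair : ℕ → Word
  pair i = suc i ∷ suc (suc i) ∷ []

  concatMap-pairs : ∀ r {a} (f : ℕ → ℕ) → (∀ i → f i ≡ i + a) →
                    concatMap pair (applyUpTo f r) ++ ascent 1 (suc n) ≡ pairs (suc a) r
  concatMap-pairs zero    f f≗ = refl
  concatMap-pairs (suc r) f f≗ =
    cong₂ (λ x xs → suc x ∷ suc (suc x) ∷ xs) (f≗ 0)
      (concatMap-pairs r (f ∘ suc) λ i → trans (f≗ (suc i)) (sym (+-suc i _)))

  wσ≡w : wσ σ ≡ w
  wσ≡w = begin
    concatMap pair (upTo (suc n)) ++ map suc (upTo σ)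
      ≡⟨ cong (concatMap pair (upTo (suc n)) ++_)
              (map-suc-applyUpTo (suc n) (λ i → i) (sym ∘ +-identityʳ)) ⟩
    concatMap pair (upTo (suc n)) ++ ascent 1 (suc n)
      ≡⟨ concatMap-pairs (suc n) (λ i → i) (sym ∘ +-identityʳ) ⟩
    w ∎
    where open ≡-Reasoning

  pairs-at : ∀ k {r} → suc k + r ≡ σ → drop (k * 2) w ≡ pairs (suc k) r
  pairs-at zero    e with suc-injective e
  ... | refl = refl
  pairs-at (suc k) {r} e =
    drop-∷ w (suc (k * 2)) (drop-∷ w (k * 2) (pairs-at k (trans (+-suc (suc k) r) e)))

  ascent-at : ∀ k {r} → suc k + r ≡ σ → drop (k + suc n * 2) w ≡ ascent (suc k) r
  ascent-at zero    e with suc-injective e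
  ... | refl = pairs-at (suc n) (+-identityʳ σ)
  ascent-at (suc k) {r} e = drop-∷ w (k + suc n * 2) (ascent-at k (trans (+-suc (suc k) r) e))

  data Shape : Word → Set where
    pairsˢ  : ∀ {a r} → a + suc r ≡ σ → Shape (pairs a (suc r))
    pairs′ˢ : ∀ {a r} → a + r ≡ σ → Shape (pairs′ a r)
    ascentˢ : ∀ {a r} → a + r ≡ σ → Shape (ascent a r)
    []ˢ     : Shape []

  shape-tail : TailClosed Shape
  shape-tail (pairsˢ {a} {r} e)       = pairs′ˢ (trans (sym (+-suc a r)) e)
  shape-tail (pairs′ˢ {r = zero} e)   = ascentˢ refl
  shape-tail (pairs′ˢ {r = suc r} e)  = pairsˢ e
  shape-tail (ascentˢ {r = zero} e)   = []ˢ
  shape-tail (ascentˢ {a} {suc r} e)  = ascentˢ (trans (sym (+-suc a r)) e)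

  -- A suffix with first letter b ≢ a shares nothing with a ∷ s, and a determines the three
  -- shapes of suffix starting with a.
  ellAt-≤-byHead : ∀ {i K a r s} → a + r ≡ σ → drop i w ≡ a ∷ s →
                   LcpBound K (a ∷ s) (pairs a r) → LcpBound K (a ∷ s) (pairs′ a r) →
                   LcpBound K (a ∷ s) (ascent a r) → ellAt w i ≤ K
  ellAt-≤-byHead {K = K} {a} {r} {s} e d bound-pairs bound-pairs′ bound-ascent =
    ellAt-≤ w λ t∈ →
      subst (λ u → LcpBound K u _) (sym d) (bounded (∈-suffixes-closed Shape shape-tail w-shape t∈))
    where
    w-shape : Shape w
    w-shape = pairsˢ {1} {n} refl

    same-r : ∀ {b r′} → b ≡ a → b + r′ ≡ σ → r ≡ r′
    same-r refl e′ = +-cancelˡ-≡ a _ _ (trans e (sym e′))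

    otherHead : ∀ {b t} → b ≢ a → LcpBound K (a ∷ s) (b ∷ t)
    otherHead {t = t} b≢a = lcpBound-≡ (lcp-∷-≢ s t (≢-sym b≢a)) z≤n

    bounded : ∀ {t} → Shape t → LcpBound K (a ∷ s) t
    bounded []ˢ = lcpBound λ _ → z≤n
    bounded (pairsˢ {b} e′) with b ≟ a
    ... | yes refl = subst (LcpBound K (a ∷ s) ∘ pairs a) (same-r refl e′) bound-pairs
    ... | no b≢a   = otherHead b≢a
    bounded (pairs′ˢ {b} e′) with b ≟ a
    ... | yes refl = subst (LcpBound K (a ∷ s) ∘ pairs′ a) (same-r refl e′) bound-pairs′
    ... | no b≢a   = otherHead b≢a
    bounded (ascentˢ {b} e′) with b ≟ a
    ... | yes refl = subst (LcpBound K (a ∷ s) ∘ ascent a) (same-r refl e′) bound-ascent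
    ... | no b≢a   = otherHead b≢a

  lcp-pairs-pairs′ : ∀ a r → lcp (pairs a (suc r)) (pairs′ a (suc r)) ≡ 1
  lcp-pairs-pairs′ a r =
    lcp-++-≢ (a ∷ []) (pairs (suc a) r) (pairs′ (suc a) r) (1+n≢n {a})

  lcp-pairs′-pairs : ∀ a r → lcp (pairs′ a (suc r)) (pairs a (suc r)) ≡ 1
  lcp-pairs′-pairs a r =
    lcp-++-≢ (a ∷ []) (pairs′ (suc a) r) (pairs (suc a) r) (≢-sym (1+n≢n {a}))

  lcp-pairs′-ascent : ∀ a r → lcp (pairs′ a (suc r)) (ascent a (suc r)) ≡ 1
  lcp-pairs′-ascent a r =
    lcp-++-≢ (a ∷ []) (pairs′ (suc a) r) (ascent⁺ (suc a) r) (≢-sym (1+n≢n {a}))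

  lcp-ascent-pairs′ : ∀ a r → lcp (ascent a (suc r)) (pairs′ a (suc r)) ≡ 1
  lcp-ascent-pairs′ a r =
    lcp-++-≢ (a ∷ []) (ascent⁺ (suc a) r) (pairs′ (suc a) r) (1+n≢n {a})

  lcp-ascent-pairs : ∀ a r → lcp (ascent a (suc (suc r))) (pairs a (suc (suc r))) ≡ 2
  lcp-ascent-pairs a r =
    lcp-++-≢ (a ∷ suc a ∷ []) (ascent⁺ (suc (suc a)) r) (pairs′ (suc (suc a)) r) (1+n≢n {suc a})

  lcp-lastPair-ascent : ∀ a → lcp (pairs a 1) (ascent a 1) ≡ 2
  lcp-lastPair-ascent a = lcp-++ (a ∷ suc a ∷ []) (ascent 1 (suc n)) []

  pairs≺ascent : ∀ a r → pairs a (suc (suc r)) ≺ ascent a (suc (suc r))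
  pairs≺ascent a r =
    trans (lexLt-++ (a ∷ suc a ∷ []) (suc a ∷ rest-pairs) (suc (suc a) ∷ rest-ascent))
          (lexLt-∷-< {suc a} {suc (suc a)} rest-pairs rest-ascent (n<1+n (suc a)))
    where
    rest-pairs rest-ascent : Word
    rest-pairs  = pairs′ (suc (suc a)) r
    rest-ascent = ascent⁺ (suc (suc a)) r

  ascent≺lastPair : ∀ a → ascent a 1 ≺ pairs a 1
  ascent≺lastPair a = lexLt-++ (a ∷ suc a ∷ []) [] (ascent 1 (suc n))

  ellAt-pairs : ∀ {i a r} → a + suc (suc r) ≡ σ → drop i w ≡ pairs a (suc (suc r)) → ellAt w i ≤ 1
  ellAt-pairs {a = a} {r} e d = ellAt-≤-byHead e d
    lcpBound-refl
    (lcpBound-≡ (lcp-pairs-pairs′ a (suc r)) ≤-refl)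
    (lcpBound-⊀ (≺-asym (pairs a (suc (suc r))) (ascent a (suc (suc r))) (pairs≺ascent a r)))

  ellAt-pairs′ : ∀ {i a r} → a + suc r ≡ σ → drop i w ≡ pairs′ a (suc r) → ellAt w i ≤ 1
  ellAt-pairs′ {a = a} {r} e d = ellAt-≤-byHead e d
    (lcpBound-≡ (lcp-pairs′-pairs a r) ≤-refl)
    lcpBound-refl
    (lcpBound-≡ (lcp-pairs′-ascent a r) ≤-refl)

  ellAt-lastPair : ∀ {i} → drop i w ≡ pairs (suc n) 1 → ellAt w i ≡ 2
  ellAt-lastPair d = ≤-antisym
    (ellAt-≤-byHead (+-comm (suc n) 1) d
      lcpBound-refl
      (lcpBound-≡ (lcp-pairs-pairs′ (suc n) 0) (s≤s z≤n))
      (lcpBound-≡ (lcp-lastPair-ascent (suc n)) ≤-refl))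
    (ellAt-≥ w (drop-∈-suffixes w (n + suc n * 2) (ascent-at n (+-comm (suc n) 1)))
      (subst (ascent (suc n) 1 ≺_) (sym d) (ascent≺lastPair (suc n)))
      (subst (λ s → 2 ≤ lcp s (ascent (suc n) 1)) (sym d)
        (≤-reflexive (sym (lcp-lastPair-ascent (suc n))))))

  ellAt-ascent : ∀ {i k r} → suc k + suc (suc r) ≡ σ → drop i w ≡ ascent (suc k) (suc (suc r)) →
                 ellAt w i ≡ 2
  ellAt-ascent {k = k} {r} e d = ≤-antisym
    (ellAt-≤-byHead e d
      (lcpBound-≡ (lcp-ascent-pairs (suc k) r) ≤-refl)
      (lcpBound-≡ (lcp-ascent-pairs′ (suc k) (suc r)) (s≤s z≤n))
      lcpBound-refl)
    (ellAt-≥ w (drop-∈-suffixes w (k * 2) (pairs-at k e))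
      (subst (pairs (suc k) (suc (suc r)) ≺_) (sym d) (pairs≺ascent (suc k) r))
      (subst (λ s → 2 ≤ lcp s (pairs (suc k) (suc (suc r)))) (sym d)
        (≤-reflexive (sym (lcp-ascent-pairs (suc k) r)))))

  ellAt-lastAscent : ∀ {i} → drop i w ≡ ascent (suc n) 1 → ellAt w i ≤ 1
  ellAt-lastAscent d = ellAt-≤-byHead (+-comm (suc n) 1) d
    (lcpBound-⊀ (≺-asym (ascent (suc n) 1) (pairs (suc n) 1) (ascent≺lastPair (suc n))))
    (lcpBound-≡ (lcp-ascent-pairs′ (suc n) 0) ≤-refl)
    lcpBound-refl

  ascent-walk : ∀ j {k i} → suc k + suc (j * 2) ≡ σ → drop i w ≡ ascent (suc k) (suc (j * 2)) →
                PhraseCount w i (j + 2)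
  ascent-walk zero {k} {i} e d with suc-injective (trans (sym (+-comm (suc k) 1)) e)
  ... | refl =
    phraseCount-short w i d (ellAt-lastAscent d)
      (phraseCount-short w (suc i) d′ (ellAt-singleton w d′)
        (phraseCount-[] w (suc (suc i)) (drop-∷ w (suc i) d′)))
    where d′ = drop-∷ w i d
  ascent-walk (suc j) {k} {i} e d =
    phraseCount-two w i d (ellAt-ascent e d)
      (ascent-walk j (trans (sym (trans (+-suc (suc k) _) (cong suc (+-suc (suc k) _)))) e)
        (drop-∷ w (suc i) (drop-∷ w i d)))

  pairs-walk : ∀ r {a i c} → a + suc r ≡ σ → drop i w ≡ pairs a (suc r) →
               (∀ {j} → drop j w ≡ ascent 1 (suc n) → PhraseCount w j c) →
               PhraseCount w i (r * 2 + suc c)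
  pairs-walk zero {a} {i} e d final with suc-injective (trans (sym (+-comm a 1)) e)
  ... | refl = phraseCount-two w i d (ellAt-lastPair d) (final (drop-∷ w (suc i) (drop-∷ w i d)))
  pairs-walk (suc r) {a} {i} e d final =
    phraseCount-short w i d (ellAt-pairs e d)
      (phraseCount-short w (suc i) d′ (ellAt-pairs′ e′ d′)
        (pairs-walk r e′ (drop-∷ w (suc i) d′) final))
    where
    d′ = drop-∷ w i d
    e′ = trans (sym (+-suc a (suc r))) e

v-wσ-even : ∀ m → v (wσ (suc m * 2)) ≡ m * 2 * 2 + suc (m + 2)
v-wσ-even m = trans (cong v wσ≡w) (phraseCount⇒v (pairs-walk (m * 2) refl refl (ascent-walk m refl)))
  where open Staircase (m * 2)

lemma5p7 : (σ : ℕ) → 2 ≤ σ → 2 ∣ σ → v (wσ σ) ≡ 2 * σ + σ / 2 ∸ 2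
lemma5p7 .(zero * 2)  ()  (divides zero refl)
lemma5p7 .(suc m * 2) _   (divides (suc m) refl) = begin
  v (wσ σ)                ≡⟨ v-wσ-even m ⟩
  m * 2 * 2 + suc (m + 2) ≡⟨ cong (_∸ 2) (closed-form m) ⟨
  2 * σ + suc m ∸ 2       ≡⟨ cong (λ h → 2 * σ + h ∸ 2) (m*n/n≡m (suc m) 2) ⟨
  2 * σ + σ / 2 ∸ 2       ∎
  where
  open ≡-Reasoning
  σ : ℕ
  σ = suc m * 2
  closed-form : ∀ m → 2 * (suc m * 2) + suc m ≡ 2 + (m * 2 * 2 + suc (m + 2))
  closed-form = solve-∀
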